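{- Let $\Delta \ge 4$ be an integer, let $G\in \mathcal{G}_\Delta$, and suppose the minimum degree $\delta$ of $G$ satisfies $\delta\le \Delta-1$. Let $c_1,\dots,c_\Delta$ be the real numbers defined by $c_\Delta=\frac{1}{\Delta}$ and $ic_{i}+c_{i+1}=1$ for $i=1,\dots,\Delta-1$, and define $f_G:V(G)\to\mathbb{R}$ by $f_G(v)=c_i$ if $v\in V_i(G)$. Then: (e) there exists $u\in V_\delta(G)$ such that $f_G(u)+\sum_{w\in N_G(u)} f_G(w)\le 1$; (f) for any $u\in V_\delta(G)$ with $f_G(u)+\sum_{w\in N_G(u)} f_G(w)\le 1$, letting $G'=G-(\{u\}\cup N_G(u))$, $M$ the set of isolated vertices of $G'$, and $C(G')$ the set of connected components $H\neq K_1$ of $G'$, we have $$\alpha(G)\ge \sum_{v\in M}f_G(v)+\sum_{H\in C(G')}\alpha(H)+f_G(u)+\sum_{w\in N_G(u)} f_G(w).$$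
   Context: All graphs are finite, simple and undirected. $\alpha(G)$ denotes the independence number of $G$, $N_G(v)$ the neighbourhood of $v$ in $G$. For an integer $\Delta\ge 3$, $\mathcal{G}_\Delta$ is the set of connected graphs $G\neq K_{\Delta+1}$ with maximum degree $\Delta$. For a graph $G$ and an integer $i\ge 1$, $V_i(G)$ denotes the set of vertices of $G$ of degree $i$. $G-S$ denotes the subgraph of $G$ induced by $V(G)\setminus S$. -}

module Defs where

open import Data.Nat as ℕ using (ℕ; zero; suc; _≤ᵇ_)
open import Data.Fin using (Fin; toℕ)
open import Data.Bool using (Bool; true; false; not; _∧_; _∨_; if_then_else_)
open import Data.List using (List; allFin; foldr)
open import Data.Integer using (+_)
open import Data.Rational as ℚ using (ℚ; 0ℚ; _/_)
open import Relation.Binary.PropositionalEquality using (_≡_; _≢_)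
open import Data.Product using (_×_; ∃)
open import Relation.Nullary.Decidable using (isYes)
import Data.Fin as Fin

record Graph (n : ℕ) : Set where
  field
    adj    : Fin n → Fin n → Bool
    sym    : ∀ u v → adj u v ≡ adj v u
    irrefl : ∀ v → adj v v ≡ false
open Graph public

VSet : ℕ → Set
VSet n = Fin n → Bool

full : ∀ {n} → VSet n
full _ = true

ℕtoℚ : ℕ → ℚ
ℕtoℚ k = + k / 1

count : ∀ {n} → VSet n → ℕ
count {n} S = foldr (λ i acc → (if S i then 1 else 0) ℕ.+ acc) 0 (allFin n)

sumℚ : ∀ {n} → (Fin n → ℚ) → ℚ
sumℚ {n} f = foldr (λ i acc → f i ℚ.+ acc) 0ℚ (allFin n)

deg : ∀ {n} → Graph n → Fin n → ℕ
deg G v = count (adj G v)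

data Reach {n} (G : Graph n) (S : VSet n) : Fin n → Fin n → Set where
  here : ∀ {v} → S v ≡ true → Reach G S v v
  step : ∀ {u v w} → S u ≡ true → adj G u v ≡ true → Reach G S v w → Reach G S u w

Connected : ∀ {n} → Graph n → Set
Connected G = ∀ u v → Reach G full u v

_⊆_ : ∀ {n} → VSet n → VSet n → Set
T ⊆ S = ∀ v → T v ≡ true → S v ≡ true

Independent : ∀ {n} → Graph n → VSet n → Set
Independent G T = ∀ u v → T u ≡ true → T v ≡ true → adj G u v ≡ false

IsIndepNum : ∀ {n} → Graph n → VSet n → ℕ → Set
IsIndepNum G S k =
  (∃ λ T → T ⊆ S × Independent G T × count T ≡ k)
  × (∀ T → T ⊆ S → Independent G T → count T ℕ.≤ k)

MaxDegree : ∀ {n} → Graph n → ℕ → Set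
MaxDegree G Δ = (∀ v → deg G v ℕ.≤ Δ) × (∃ λ v → deg G v ≡ Δ)

MinDegree : ∀ {n} → Graph n → ℕ → Set
MinDegree G δ = (∀ v → δ ℕ.≤ deg G v) × (∃ λ v → deg G v ≡ δ)

IsComplete : ∀ {n} → Graph n → ℕ → Set
IsComplete {n} G m = n ≡ m × (∀ u v → u ≢ v → adj G u v ≡ true)

closedSum : ∀ {n} → Graph n → (Fin n → ℚ) → Fin n → ℚ
closedSum G f u = f u ℚ.+ sumℚ (λ w → if adj G u w then f w else 0ℚ)

minusClosedNbhd : ∀ {n} → Graph n → Fin n → VSet n
minusClosedNbhd G u w = not (isYes (u Fin.≟ w)) ∧ not (adj G u w)

isolatedIn : ∀ {n} → Graph n → VSet n → Fin n → Bool
isolatedIn {n} G S v = S v ∧ not (foldr (λ w b → (S w ∧ adj G v w) ∨ b) false (allFin n))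

-- Given R deciding reachability in G[S] (R v w ≡ true ⇔ Reach G S v w),
-- v is the representative (least-index vertex) of a component H ≠ K_1 of G[S].
isCompRep : ∀ {n} → Graph n → VSet n → (Fin n → Fin n → Bool) → Fin n → Bool
isCompRep {n} G S R v =
  S v ∧ not (isolatedIn G S v)
      ∧ foldr (λ w b → (not (R v w) ∨ (toℕ v ≤ᵇ toℕ w)) ∧ b) true (allFin n)

-- The coefficients lie in [0,1] and are non-increasing on 1,…,Δ: by downward
-- induction from Δ c_Δ = 1, each i c_i = 1 − c_{i+1} lies in [0,1], and
-- i c_{i+1} + c_{i+1} = (i+1) c_{i+1} ≤ 1 = i c_i + c_{i+1}.
--
-- (e) As δ < Δ and G is connected, a walk from a vertex of degree δ to one of
-- degree Δ leaves the degree-δ vertices along an edge uy.  Every neighbour of u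
-- weighs at most c_δ, and y at most c_{δ+1}, so the closed neighbourhood of u
-- weighs at most δ c_δ + c_{δ+1} = 1.
--
-- (f) u, the isolated vertices of G', and a maximum independent set of each
-- nontrivial component of G' together form an independent set of G of size
-- 1 + |M| + Σ α(H).  It dominates the three weighted terms since f ≤ 1.

module Submission where

open import Defs
open import Data.Nat using (ℕ; suc; _≤_; _∸_)
open import Data.Fin using (Fin)
open import Data.Bool using (Bool; true; if_then_else_)
open import Data.Product using (_×_; ∃)
open import Data.Rational as ℚ using (ℚ; 0ℚ; 1ℚ)
open import Relation.Binary.PropositionalEquality using (_≡_)
open import Relation.Nullary using (¬_)
open import Function.Bundles using (_⇔_)

open import Data.Nat using (_+_; _<_; _≤ᵇ_; z≤n; s≤s; _≤‴_; ≤‴-refl; ≤‴-step)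
import Data.Nat.Properties as ℕ
open import Data.Nat.Coprimality using (1-coprimeTo) renaming (sym to coprime-sym)
import Data.Integer as ℤ
import Data.Integer.Properties as ℤ
open import Data.Rational using (mkℚ; _/_)
import Data.Rational.Properties as ℚ
open import Data.Rational.Solver using (module +-*-Solver)
open import Data.Fin using (toℕ)
import Data.Fin as Fin
import Data.Fin.Properties as Fin
open import Data.Bool using (false; not; _∧_; _∨_)
open import Data.Bool.Properties using (∧-zeroʳ; T-≡)
open import Data.List using (List; []; _∷_; foldr; allFin)
open import Data.List.Membership.Propositional using (_∈_)
open import Data.List.Membership.Propositional.Properties using (∈-allFin)
open import Data.List.Relation.Unary.Any using (here; there; tail)
open import Data.List.Relation.Unary.All as All using (All)
open import Data.List.Relation.Unary.Unique.Propositional using (Unique; []; _∷_)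
open import Data.List.Relation.Unary.Unique.Propositional.Properties using (allFin⁺)
open import Data.Product using (Σ; ∃₂; _,_; proj₁; proj₂)
open import Data.Sum using (_⊎_; inj₁; inj₂)
open import Function using (_∘_)
open import Function.Bundles using (module Equivalence)
open import Level using (0ℓ)
open import Algebra.Bundles using (module CommutativeMonoid)
import Algebra.Properties.CommutativeSemigroup ℕ.+-commutativeSemigroup as ℕ+
import Algebra.Properties.CommutativeSemigroup
  (CommutativeMonoid.commutativeSemigroup ℚ.+-0-commutativeMonoid) as ℚ+
open import Relation.Nullary using (yes; no; contradiction)
open import Relation.Nullary.Decidable using (isYes)
open import Relation.Unary using (Pred; Decidable)
open import Relation.Binary.PropositionalEquality as ≡
  using (_≢_; refl; trans; cong; cong₂; subst; subst₂; module ≡-Reasoning)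

-- ℕtoℚ k is a normalised fraction, which does not compute for a variable k.
ℕtoℚ≡mkℚ : ∀ k → ℕtoℚ k ≡ mkℚ (ℤ.+ k) 0 (coprime-sym (1-coprimeTo k))
ℕtoℚ≡mkℚ k = ℚ.normalize-coprime (coprime-sym (1-coprimeTo k))

ℕtoℚ-+ : ∀ m n → ℕtoℚ (m + n) ≡ ℕtoℚ m ℚ.+ ℕtoℚ n
ℕtoℚ-+ m n rewrite ℕtoℚ≡mkℚ m | ℕtoℚ≡mkℚ n =
  ≡.sym (cong₂ (λ p q → (p ℤ.+ q) / 1) (ℤ.*-identityʳ (ℤ.+ m)) (ℤ.*-identityʳ (ℤ.+ n)))

ℕtoℚ-mono-≤ : ∀ {m n} → m ≤ n → ℕtoℚ m ℚ.≤ ℕtoℚ n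
ℕtoℚ-mono-≤ {m} {n} m≤n rewrite ℕtoℚ≡mkℚ m | ℕtoℚ≡mkℚ n =
  ℚ.*≤* (subst₂ ℤ._≤_ (≡.sym (ℤ.*-identityʳ (ℤ.+ m))) (≡.sym (ℤ.*-identityʳ (ℤ.+ n))) (ℤ.+≤+ m≤n))

ℕtoℚ-positive : ∀ k → ℚ.Positive (ℕtoℚ (suc k))
ℕtoℚ-positive k rewrite ℕtoℚ≡mkℚ (suc k) = _

ℕtoℚ-suc-* : ∀ i x → ℕtoℚ (suc i) ℚ.* x ≡ ℕtoℚ i ℚ.* x ℚ.+ x
ℕtoℚ-suc-* i x rewrite ℕtoℚ-+ 1 i =
  solve 2 (λ i x → (con 1ℚ :+ i) :* x := i :* x :+ x) refl (ℕtoℚ i) x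
  where open +-*-Solver

ℕtoℚ-if : ∀ b m k → (if b then ℕtoℚ m else ℕtoℚ k) ≡ ℕtoℚ (if b then m else k)
ℕtoℚ-if true  m k = refl
ℕtoℚ-if false m k = refl

*-cancelˡ-≤-ℕtoℚ : ∀ {i x y} → 1 ≤ i → ℕtoℚ i ℚ.* x ℚ.≤ ℕtoℚ i ℚ.* y → x ℚ.≤ y
*-cancelˡ-≤-ℕtoℚ {suc k} _ = ℚ.*-cancelˡ-≤-pos (ℕtoℚ (suc k)) {{ℕtoℚ-positive k}}

x≤ℕtoℚ*x : ∀ {i x} → 1 ≤ i → 0ℚ ℚ.≤ x → x ℚ.≤ ℕtoℚ i ℚ.* x
x≤ℕtoℚ*x {i} {x} 1≤i 0≤x = subst (ℚ._≤ ℕtoℚ i ℚ.* x) (ℚ.*-identityˡ x)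
  (ℚ.*-monoʳ-≤-nonNeg x {{ℚ.nonNegative 0≤x}} (ℕtoℚ-mono-≤ 1≤i))

+-cancelʳ-≤ : ∀ a {b c} → b ℚ.+ a ℚ.≤ c ℚ.+ a → b ℚ.≤ c
+-cancelʳ-≤ a {b} {c} h = subst₂ ℚ._≤_ (cancel b) (cancel c) (ℚ.+-monoˡ-≤ (ℚ.- a) h)
  where
  open +-*-Solver
  cancel : ∀ x → x ℚ.+ a ℚ.- a ≡ x
  cancel x = solve 2 (λ x a → x :+ a :- a := x) refl x a

_∈[0,1] : ℚ → Set
x ∈[0,1] = 0ℚ ℚ.≤ x × x ℚ.≤ 1ℚ

1∈[0,1] : 1ℚ ∈[0,1]
1∈[0,1] = ℕtoℚ-mono-≤ {0} {1} z≤n , ℚ.≤-refl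

complement-∈[0,1] : ∀ {a b} → a ℚ.+ b ≡ 1ℚ → b ∈[0,1] → a ∈[0,1]
complement-∈[0,1] {a} {b} a+b≡1 (0≤b , b≤1) =
  +-cancelʳ-≤ b (subst₂ ℚ._≤_ (≡.sym (ℚ.+-identityˡ b)) (≡.sym a+b≡1) b≤1) ,
  subst (a ℚ.≤_) a+b≡1 (subst (ℚ._≤ a ℚ.+ b) (ℚ.+-identityʳ a) (ℚ.+-monoʳ-≤ a 0≤b))

unscale-∈[0,1] : ∀ {i x} → 1 ≤ i → (ℕtoℚ i ℚ.* x) ∈[0,1] → x ∈[0,1]
unscale-∈[0,1] {i} {x} 1≤i (0≤ix , ix≤1) = 0≤x , ℚ.≤-trans (x≤ℕtoℚ*x 1≤i 0≤x) ix≤1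
  where
  0≤x : 0ℚ ℚ.≤ x
  0≤x = *-cancelˡ-≤-ℕtoℚ {i} 1≤i (subst (ℚ._≤ ℕtoℚ i ℚ.* x) (≡.sym (ℚ.*-zeroʳ (ℕtoℚ i))) 0≤ix)

∧-true : ∀ {x y} → x ∧ y ≡ true → x ≡ true × y ≡ true
∧-true {true} y≡true = refl , y≡true

∨-true : ∀ {x y} → x ∨ y ≡ true → x ≡ true ⊎ y ≡ true
∨-true {true}  _      = inj₁ refl
∨-true {false} y≡true = inj₂ y≡true

not≡true : ∀ {x} → not x ≡ true → x ≡ false
not≡true {false} _ = refl

indicator : Bool → ℕ
indicator b = if b then 1 else 0

-- These folds are the ones of Defs: sumℚ f = Σℚ (allFin n) f and
-- count S = Σℕ (allFin n) (indicator ∘ S) hold definitionally, and isolatedIn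
-- and isCompRep are built from anyᵇ and allᵇ.
module _ {A : Set} where

  Σℚ : List A → (A → ℚ) → ℚ
  Σℚ L f = foldr (λ x s → f x ℚ.+ s) 0ℚ L

  Σℕ : List A → (A → ℕ) → ℕ
  Σℕ L f = foldr (λ x s → f x + s) 0 L

  anyᵇ : List A → (A → Bool) → Bool
  anyᵇ L p = foldr (λ x b → p x ∨ b) false L

  allᵇ : List A → (A → Bool) → Bool
  allᵇ L p = foldr (λ x b → p x ∧ b) true L

  Σℚ-mono-≤ : ∀ L {f g : A → ℚ} → (∀ x → f x ℚ.≤ g x) → Σℚ L f ℚ.≤ Σℚ L g
  Σℚ-mono-≤ []      f≤g = ℚ.≤-refl
  Σℚ-mono-≤ (x ∷ L) f≤g = ℚ.+-mono-≤ (f≤g x) (Σℚ-mono-≤ L f≤g)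

  Σℚ-+ : ∀ L (f g : A → ℚ) → Σℚ L (λ x → f x ℚ.+ g x) ≡ Σℚ L f ℚ.+ Σℚ L g
  Σℚ-+ []      f g = refl
  Σℚ-+ (x ∷ L) f g = trans (cong ((f x ℚ.+ g x) ℚ.+_) (Σℚ-+ L f g))
                        (ℚ+.interchange (f x) (g x) (Σℚ L f) (Σℚ L g))

  Σℚ-indicator : ∀ L (P : A → Bool) q →
                 Σℚ L (λ x → if P x then q else 0ℚ) ≡ ℕtoℚ (Σℕ L (indicator ∘ P)) ℚ.* q
  Σℚ-indicator []      P q = ≡.sym (ℚ.*-zeroˡ q)
  Σℚ-indicator (x ∷ L) P q with P x
  ... | true  = trans (cong (q ℚ.+_) (Σℚ-indicator L P q))
                  (trans (ℚ.+-comm q _) (≡.sym (ℕtoℚ-suc-* (Σℕ L (indicator ∘ P)) q)))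
  ... | false = trans (ℚ.+-identityˡ _) (Σℚ-indicator L P q)

  Σℚ-ℕtoℚ : ∀ L {f : A → ℚ} {g : A → ℕ} → (∀ x → f x ≡ ℕtoℚ (g x)) → Σℚ L f ≡ ℕtoℚ (Σℕ L g)
  Σℚ-ℕtoℚ []      f≡g = refl
  Σℚ-ℕtoℚ (x ∷ L) {g = g} f≡g =
    trans (cong₂ ℚ._+_ (f≡g x) (Σℚ-ℕtoℚ L f≡g)) (≡.sym (ℕtoℚ-+ (g x) (Σℕ L g)))

  Σℕ-+ : ∀ L (f g : A → ℕ) → Σℕ L (λ x → f x + g x) ≡ Σℕ L f + Σℕ L g
  Σℕ-+ []      f g = refl
  Σℕ-+ (x ∷ L) f g = trans (cong ((f x + g x) +_) (Σℕ-+ L f g))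
                        (ℕ+.interchange (f x) (g x) (Σℕ L f) (Σℕ L g))

  Σℕ-cong : ∀ L {f g : A → ℕ} → (∀ x → f x ≡ g x) → Σℕ L f ≡ Σℕ L g
  Σℕ-cong []      f≡g = refl
  Σℕ-cong (x ∷ L) f≡g = cong₂ _+_ (f≡g x) (Σℕ-cong L f≡g)

  Σℕ-zero : ∀ {L} {f : A → ℕ} → All (λ x → f x ≡ 0) L → Σℕ L f ≡ 0
  Σℕ-zero All.[]           = refl
  Σℕ-zero (fx≡0 All.∷ all) = cong₂ _+_ fx≡0 (Σℕ-zero all)

  Σℕ-indicator-positive : ∀ L (P : A → Bool) {x} → x ∈ L → P x ≡ true → 1 ≤ Σℕ L (indicator ∘ P)
  Σℕ-indicator-positive (y ∷ L) P (here refl) Px rewrite Px = s≤s z≤n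
  Σℕ-indicator-positive (y ∷ L) P (there x∈L) Px =
    ℕ.≤-trans (Σℕ-indicator-positive L P x∈L Px) (ℕ.m≤n+m _ (indicator (P y)))

  anyᵇ-intro : ∀ L (p : A → Bool) {x} → x ∈ L → p x ≡ true → anyᵇ L p ≡ true
  anyᵇ-intro (y ∷ L) p (here refl) px rewrite px = refl
  anyᵇ-intro (y ∷ L) p (there x∈L) px with p y
  ... | true  = refl
  ... | false = anyᵇ-intro L p x∈L px

  anyᵇ-elim : ∀ L (p : A → Bool) → anyᵇ L p ≡ true → ∃ λ x → x ∈ L × p x ≡ true
  anyᵇ-elim (y ∷ L) p h with p y in py
  ... | true  = y , here refl , py
  ... | false with anyᵇ-elim L p h
  ...   | x , x∈L , px = x , there x∈L , px

  allᵇ-elim : ∀ L (p : A → Bool) → allᵇ L p ≡ true → ∀ {x} → x ∈ L → p x ≡ true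
  allᵇ-elim (y ∷ L) p h (here refl) = proj₁ (∧-true h)
  allᵇ-elim (y ∷ L) p h (there x∈L) = allᵇ-elim L p (proj₂ (∧-true {p y} h)) x∈L

Σℕ-indicator-≟ : ∀ {n} {L : List (Fin n)} {y} → Unique L → y ∈ L →
                 Σℕ L (λ x → indicator (isYes (y Fin.≟ x))) ≡ 1
Σℕ-indicator-≟ {L = x ∷ L} {y} (x∉L ∷ unique) y∈ with y Fin.≟ x
... | yes refl = cong suc (Σℕ-zero (All.map vanish x∉L))
  where
  vanish : ∀ {z} → y ≢ z → indicator (isYes (y Fin.≟ z)) ≡ 0
  vanish {z} y≢z with y Fin.≟ z
  ... | yes y≡z = contradiction y≡z y≢z
  ... | no _    = refl
... | no y≢x = Σℕ-indicator-≟ unique (tail y≢x y∈)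

module _ {n : ℕ} where

  ∅ : VSet n
  ∅ _ = false

  ｛_｝ : Fin n → VSet n
  ｛ u ｝ w = isYes (u Fin.≟ w)

  _∪_ : VSet n → VSet n → VSet n
  (S ∪ T) w = S w ∨ T w

  ⋃ : ∀ {I : Set} → List I → (I → VSet n) → VSet n
  ⋃ L T w = anyᵇ L (λ i → T i w)

  ｛｝-elim : ∀ {u w} → ｛ u ｝ w ≡ true → u ≡ w
  ｛｝-elim {u} {w} h with u Fin.≟ w
  ... | yes u≡w = u≡w

  count-positive : ∀ (S : VSet n) {v} → S v ≡ true → 1 ≤ count S
  count-positive S Sv = Σℕ-indicator-positive (allFin n) S (∈-allFin _) Sv

  count-∅ : count ∅ ≡ 0
  count-∅ = Σℕ-zero (All.universal (λ _ → refl) (allFin n))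

  count-｛｝ : ∀ u → count ｛ u ｝ ≡ 1
  count-｛｝ u = Σℕ-indicator-≟ (allFin⁺ n) (∈-allFin u)

  count-∪ : ∀ {S T : VSet n} → (∀ w → S w ≡ true → T w ≡ false) → count (S ∪ T) ≡ count S + count T
  count-∪ {S} {T} disjoint = trans (Σℕ-cong (allFin n) split) (Σℕ-+ (allFin n) _ _)
    where
    split : ∀ w → indicator (S w ∨ T w) ≡ indicator (S w) + indicator (T w)
    split w with S w in Sw
    ... | true  rewrite disjoint w Sw = refl
    ... | false = refl

  count-⋃ : ∀ {I : Set} (L : List I) (T : I → VSet n) → Unique L →
            (∀ {i j w} → T i w ≡ true → T j w ≡ true → i ≡ j) →
            count (⋃ L T) ≡ Σℕ L (count ∘ T)
  count-⋃ []      T _              disjoint = count-∅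
  count-⋃ (i ∷ L) T (i∉L ∷ unique) disjoint =
    trans (count-∪ separate) (cong (count (T i) +_) (count-⋃ L T unique disjoint))
    where
    separate : ∀ w → T i w ≡ true → ⋃ L T w ≡ false
    separate w Tiw with ⋃ L T w in h
    ... | false = refl
    ... | true with anyᵇ-elim L (λ j → T j w) h
    ...   | j , j∈L , Tjw = contradiction (disjoint Tiw Tjw) (All.lookup i∉L j∈L)

module _ {n : ℕ} (G : Graph n) where

  ∪-independent : ∀ {S T} → Independent G S → Independent G T →
                  (∀ p q → S p ≡ true → T q ≡ true → adj G p q ≡ false) →
                  Independent G (S ∪ T)
  ∪-independent indS indT cross p q Ip Iq with ∨-true Ip | ∨-true Iq
  ... | inj₁ Sp | inj₁ Sq = indS p q Sp Sq
  ... | inj₁ Sp | inj₂ Tq = cross p q Sp Tq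
  ... | inj₂ Tp | inj₁ Sq = trans (sym G p q) (cross q p Sq Tp)
  ... | inj₂ Tp | inj₂ Tq = indT p q Tp Tq

  module _ {S : VSet n} where

    reach-source : ∀ {a b} → Reach G S a b → S a ≡ true
    reach-source (here Sa)     = Sa
    reach-source (step Sa _ _) = Sa

    reach-trans : ∀ {a b c} → Reach G S a b → Reach G S b c → Reach G S a c
    reach-trans (here _)      r′ = r′
    reach-trans (step Sa e r)  r′ = step Sa e (reach-trans r r′)

    reach-sym : ∀ {a b} → Reach G S a b → Reach G S b a
    reach-sym (here Sa) = here Sa
    reach-sym {a} (step {v = v} Sa a~v r) =
      reach-trans (reach-sym r) (step (reach-source r) (trans (sym G v a) a~v) (here Sa))

    reach-neighbour : ∀ {a b} → Reach G S a b → a ≢ b → ∃ λ x → adj G a x ≡ true × S x ≡ true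
    reach-neighbour (here _)               a≢a = contradiction refl a≢a
    reach-neighbour (step {v = v} _ a~v r) _   = v , a~v , reach-source r

    walk-crosses : ∀ {P : Pred (Fin n) 0ℓ} → Decidable P → ∀ {a b} → Reach G S a b → P a → ¬ P b →
                   ∃₂ λ x y → P x × adj G x y ≡ true × ¬ P y
    walk-crosses P? (here _) Pa ¬Pb = contradiction Pa ¬Pb
    walk-crosses P? (step {v = v} _ a~v r) Pa ¬Pb with P? v
    ... | yes Pv  = walk-crosses P? r Pv ¬Pb
    ... | no ¬Pv = _ , v , Pa , a~v , ¬Pv

  degree-positive : Connected G → ∀ {z} → 1 ≤ deg G z → ∀ w → 1 ≤ deg G w
  degree-positive connected {z} 1≤dz w with w Fin.≟ z
  ... | yes refl = 1≤dz
  ... | no w≢z with reach-neighbour (connected w z) w≢z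
  ...   | x , w~x , _ = count-positive (adj G w) w~x

  module _ (S : VSet n) where

    isolated⇒∈ : ∀ {v} → isolatedIn G S v ≡ true → S v ≡ true
    isolated⇒∈ = proj₁ ∘ ∧-true

    neighbour⇒¬isolated : ∀ {v x} → S x ≡ true → adj G v x ≡ true → isolatedIn G S v ≡ false
    neighbour⇒¬isolated {v} {x} Sx v~x
      rewrite anyᵇ-intro (allFin n) (λ w → S w ∧ adj G v w) (∈-allFin x) (cong₂ _∧_ Sx v~x)
      = ∧-zeroʳ (S v)

    isolated⇒no-edge : ∀ {v x} → isolatedIn G S v ≡ true → S x ≡ true → adj G v x ≡ false
    isolated⇒no-edge {v} {x} iso Sx with adj G v x in v~x
    ... | false = refl
    ... | true  = contradiction (trans (≡.sym iso) (neighbour⇒¬isolated Sx v~x)) λ ()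

module Components {n : ℕ} (G : Graph n) (S : VSet n) (R : Fin n → Fin n → Bool)
  (R⇔Reach : ∀ v w → (R v w ≡ true) ⇔ Reach G S v w)
  (a : Fin n → ℕ)
  (a-indep : ∀ v → isCompRep G S R v ≡ true → IsIndepNum G (R v) (a v)) where

  rep iso : Fin n → Bool
  rep = isCompRep G S R
  iso = isolatedIn G S

  reach : ∀ {v w} → R v w ≡ true → Reach G S v w
  reach = Equivalence.to (R⇔Reach _ _)

  unreach : ∀ {v w} → Reach G S v w → R v w ≡ true
  unreach = Equivalence.from (R⇔Reach _ _)

  R⇒∈ : ∀ {v w} → R v w ≡ true → S w ≡ true
  R⇒∈ Rvw = reach-source G (reach-sym G (reach Rvw))

  rep⇒¬isolated : ∀ {v} → rep v ≡ true → iso v ≡ false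
  rep⇒¬isolated {v} r = not≡true (proj₁ (∧-true (proj₂ (∧-true {S v} r))))

  rep⇒minimal : ∀ {v w} → rep v ≡ true → R v w ≡ true → toℕ v ≤ toℕ w
  rep⇒minimal {v} {w} r Rvw = ℕ.≤ᵇ⇒≤ (toℕ v) (toℕ w) (Equivalence.from T-≡ v≤ᵇw)
    where
    ordered : not (R v w) ∨ (toℕ v ≤ᵇ toℕ w) ≡ true
    ordered = allᵇ-elim (allFin n) (λ x → not (R v x) ∨ (toℕ v ≤ᵇ toℕ x))
                (proj₂ (∧-true {not (iso v)} (proj₂ (∧-true {S v} r)))) (∈-allFin w)
    v≤ᵇw : (toℕ v ≤ᵇ toℕ w) ≡ true
    v≤ᵇw = subst (λ b → not b ∨ (toℕ v ≤ᵇ toℕ w) ≡ true) Rvw ordered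

  reps-unique : ∀ {v v′ w} → rep v ≡ true → rep v′ ≡ true → R v w ≡ true → R v′ w ≡ true → v ≡ v′
  reps-unique r r′ Rvw Rv′w =
    Fin.toℕ-injective (ℕ.≤-antisym (rep⇒minimal r (link Rvw Rv′w)) (rep⇒minimal r′ (link Rv′w Rvw)))
    where
    link : ∀ {p q w} → R p w ≡ true → R q w ≡ true → R p q ≡ true
    link Rpw Rqw = unreach (reach-trans G (reach Rpw) (reach-sym G (reach Rqw)))

  componentSet : ∀ v → Σ (VSet n) λ T → T ⊆ (λ w → rep v ∧ R v w) × Independent G T
                                       × count T ≡ (if rep v then a v else 0)
  componentSet v with rep v in r
  ... | true  = proj₁ (a-indep v r)
  ... | false = ∅ , (λ _ ()) , (λ _ _ ()) , count-∅ {n}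

  part : Fin n → VSet n
  part v = proj₁ (componentSet v)

  part-independent : ∀ v → Independent G (part v)
  part-independent v = proj₁ (proj₂ (proj₂ (componentSet v)))

  part-count : ∀ v → count (part v) ≡ (if rep v then a v else 0)
  part-count v = proj₂ (proj₂ (proj₂ (componentSet v)))

  part⇒rep : ∀ {v w} → part v w ≡ true → rep v ≡ true × R v w ≡ true
  part⇒rep {v} {w} h = ∧-true (proj₁ (proj₂ (componentSet v)) w h)

  part⇒∈ : ∀ {v w} → part v w ≡ true → S w ≡ true
  part⇒∈ h = R⇒∈ (proj₂ (part⇒rep h))

  part⇒¬isolated : ∀ {v w} → part v w ≡ true → iso w ≡ false
  part⇒¬isolated {v} {w} h with w Fin.≟ v
  ... | yes refl = rep⇒¬isolated (proj₁ (part⇒rep h))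
  ... | no w≢v with reach-neighbour G (reach-sym G (reach (proj₂ (part⇒rep h)))) w≢v
  ...   | x , w~x , Sx = neighbour⇒¬isolated G S Sx w~x

  parts-disjoint : ∀ {v v′ w} → part v w ≡ true → part v′ w ≡ true → v ≡ v′
  parts-disjoint h h′ with part⇒rep h | part⇒rep h′
  ... | r , Rvw | r′ , Rv′w = reps-unique r r′ Rvw Rv′w

  R-step : ∀ {v p q} → R v p ≡ true → adj G p q ≡ true → S q ≡ true → R v q ≡ true
  R-step Rvp p~q Sq =
    unreach (reach-trans G (reach Rvp) (step (R⇒∈ Rvp) p~q (here Sq)))

  -- An edge pq with p in the part of v puts q in the component of v.
  parts-no-edge : ∀ {v v′ p q} → part v p ≡ true → part v′ q ≡ true → adj G p q ≡ false
  parts-no-edge {v} {v′} {p} {q} hp hq with adj G p q in p~q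
  ... | false = refl
  ... | true with part⇒rep hp | part⇒rep hq
  ...   | r , Rvp | r′ , Rv′q with reps-unique r r′ (R-step Rvp p~q (part⇒∈ hq)) Rv′q
  ...     | refl = trans (≡.sym p~q) (part-independent v p q hp hq)

  selection : VSet n
  selection = iso ∪ ⋃ (allFin n) part

  ⋃-part-elim : ∀ {w} → ⋃ (allFin n) part w ≡ true → ∃ λ v → part v w ≡ true
  ⋃-part-elim h with anyᵇ-elim (allFin n) _ h
  ... | v , _ , hv = v , hv

  selection-⊆ : selection ⊆ S
  selection-⊆ w h with ∨-true h
  ... | inj₁ iw = isolated⇒∈ G S iw
  ... | inj₂ hw = part⇒∈ (proj₂ (⋃-part-elim hw))

  selection-independent : Independent G selection
  selection-independent = ∪-independent G isolated-independent parts-independent isolated-parts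
    where
    isolated-independent : Independent G iso
    isolated-independent p q ip iq = isolated⇒no-edge G S ip (isolated⇒∈ G S iq)
    parts-independent : Independent G (⋃ (allFin n) part)
    parts-independent p q hp hq = parts-no-edge (proj₂ (⋃-part-elim hp)) (proj₂ (⋃-part-elim hq))
    isolated-parts : ∀ p q → iso p ≡ true → ⋃ (allFin n) part q ≡ true → adj G p q ≡ false
    isolated-parts p q ip hq = isolated⇒no-edge G S ip (part⇒∈ (proj₂ (⋃-part-elim hq)))

  selection-count : count selection ≡ count iso + Σℕ (allFin n) (λ v → if rep v then a v else 0)
  selection-count = begin
    count selection
      ≡⟨ count-∪ isolated∉parts ⟩
    count iso + count (⋃ (allFin n) part)
      ≡⟨ cong (count iso +_) (count-⋃ (allFin n) part (allFin⁺ n) parts-disjoint) ⟩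
    count iso + Σℕ (allFin n) (count ∘ part)
      ≡⟨ cong (count iso +_) (Σℕ-cong (allFin n) part-count) ⟩
    count iso + Σℕ (allFin n) (λ v → if rep v then a v else 0) ∎
    where
    open ≡-Reasoning
    isolated∉parts : ∀ w → iso w ≡ true → ⋃ (allFin n) part w ≡ false
    isolated∉parts w iw with ⋃ (allFin n) part w in hw
    ... | false = refl
    ... | true  = contradiction (trans (≡.sym iw) (part⇒¬isolated (proj₂ (⋃-part-elim hw)))) λ ()

module _ {n : ℕ} (G : Graph n) (u : Fin n) where

  minusClosedNbhd⇒ : ∀ {w} → minusClosedNbhd G u w ≡ true → u ≢ w × adj G u w ≡ false
  minusClosedNbhd⇒ {w} h with u Fin.≟ w | adj G u w
  minusClosedNbhd⇒ () | yes _ | _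
  minusClosedNbhd⇒ () | no _  | true
  ... | no u≢w | false = u≢w , refl

  add-closedNbhd-centre : ∀ {T} → T ⊆ minusClosedNbhd G u → Independent G T →
                          Independent G (｛ u ｝ ∪ T) × count (｛ u ｝ ∪ T) ≡ suc (count T)
  add-closedNbhd-centre {T} T⊆ indT =
    ∪-independent G centre-independent indT centre-no-edge ,
    trans (count-∪ centre∉T) (cong (_+ count T) (count-｛｝ u))
    where
    centre-independent : Independent G ｛ u ｝
    centre-independent p q hp hq with ｛｝-elim hp | ｛｝-elim hq
    ... | refl | refl = irrefl G u
    centre-no-edge : ∀ p q → ｛ u ｝ p ≡ true → T q ≡ true → adj G p q ≡ false
    centre-no-edge p q hp Tq with ｛｝-elim hp
    ... | refl = proj₂ (minusClosedNbhd⇒ (T⊆ q Tq))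
    centre∉T : ∀ w → ｛ u ｝ w ≡ true → T w ≡ false
    centre∉T w hw with ｛｝-elim hw | T w in Tw
    ... | refl | true  = contradiction refl (proj₁ (minusClosedNbhd⇒ (T⊆ u Tw)))
    ... | refl | false = refl

independence-lower-bound :
  ∀ {n} (G : Graph n) (f : Fin n → ℚ) → (∀ v → f v ℚ.≤ 1ℚ)
  → ∀ u → closedSum G f u ℚ.≤ 1ℚ
  → let S = minusClosedNbhd G u
    in (R : Fin n → Fin n → Bool)
       → (∀ v w → (R v w ≡ true) ⇔ Reach G S v w)
       → (a : Fin n → ℕ)
       → (∀ v → isCompRep G S R v ≡ true → IsIndepNum G (R v) (a v))
       → (α : ℕ) → IsIndepNum G full α
       → sumℚ (λ v → if isolatedIn G S v then f v else 0ℚ)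
           ℚ.+ sumℚ (λ v → if isCompRep G S R v then ℕtoℚ (a v) else 0ℚ)
           ℚ.+ closedSum G f u
         ℚ.≤ ℕtoℚ α
independence-lower-bound {n} G f f≤1 u closed≤1 R R⇔Reach a a-indep α (_ , α-max) = begin
    sumℚ (λ v → if iso v then f v else 0ℚ)
      ℚ.+ sumℚ (λ v → if rep v then ℕtoℚ (a v) else 0ℚ)
      ℚ.+ closedSum G f u
      ≤⟨ ℚ.+-mono-≤ (ℚ.+-mono-≤ isolated-weight (ℚ.≤-reflexive component-weight)) closed≤1 ⟩
    ℕtoℚ (count iso) ℚ.+ ℕtoℚ components ℚ.+ ℕtoℚ 1
      ≡⟨ cong (ℚ._+ ℕtoℚ 1) (ℕtoℚ-+ (count iso) components) ⟨
    ℕtoℚ (count iso + components) ℚ.+ ℕtoℚ 1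
      ≡⟨ ℕtoℚ-+ (count iso + components) 1 ⟨
    ℕtoℚ (count iso + components + 1)
      ≡⟨ cong ℕtoℚ (trans (ℕ.+-comm _ 1) (≡.sym size)) ⟩
    ℕtoℚ (count (｛ u ｝ ∪ selection))
      ≤⟨ ℕtoℚ-mono-≤ (α-max _ (λ _ _ → refl) (proj₁ extended)) ⟩
    ℕtoℚ α ∎
  where
  open ℚ.≤-Reasoning
  open Components G (minusClosedNbhd G u) R R⇔Reach a a-indep
  components : ℕ
  components = Σℕ (allFin n) (λ v → if rep v then a v else 0)
  extended : Independent G (｛ u ｝ ∪ selection) × count (｛ u ｝ ∪ selection) ≡ suc (count selection)
  extended = add-closedNbhd-centre G u selection-⊆ selection-independent
  size : count (｛ u ｝ ∪ selection) ≡ suc (count iso + components)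
  size = trans (proj₂ extended) (cong suc selection-count)
  isolated-weight : sumℚ (λ v → if iso v then f v else 0ℚ) ℚ.≤ ℕtoℚ (count iso)
  isolated-weight = ℚ.≤-trans (Σℚ-mono-≤ (allFin n) bounded)
                      (ℚ.≤-reflexive (Σℚ-ℕtoℚ (allFin n) (λ v → ℕtoℚ-if (iso v) 1 0)))
    where
    bounded : ∀ v → (if iso v then f v else 0ℚ) ℚ.≤ (if iso v then 1ℚ else 0ℚ)
    bounded v with iso v
    ... | true  = f≤1 v
    ... | false = ℚ.≤-refl
  component-weight : sumℚ (λ v → if rep v then ℕtoℚ (a v) else 0ℚ) ≡ ℕtoℚ components
  component-weight = Σℚ-ℕtoℚ (allFin n) (λ v → ℕtoℚ-if (rep v) (a v) 0)

module Coefficients (Δ : ℕ) (c : ℕ → ℚ)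
  (c-top : ℕtoℚ Δ ℚ.* c Δ ≡ 1ℚ)
  (c-step : ∀ i → 1 ≤ i → suc i ≤ Δ → ℕtoℚ i ℚ.* c i ℚ.+ c (suc i) ≡ 1ℚ) where

  scaled-c∈[0,1] : ∀ {i} → 1 ≤ i → i ≤‴ Δ → (ℕtoℚ i ℚ.* c i) ∈[0,1]
  scaled-c∈[0,1] _ ≤‴-refl = subst _∈[0,1] (≡.sym c-top) 1∈[0,1]
  scaled-c∈[0,1] {i} 1≤i (≤‴-step i<‴Δ) =
    complement-∈[0,1] (c-step i 1≤i (ℕ.≤‴⇒≤ i<‴Δ))
      (unscale-∈[0,1] {suc i} (s≤s z≤n) (scaled-c∈[0,1] (s≤s z≤n) i<‴Δ))

  c∈[0,1] : ∀ {i} → 1 ≤ i → i ≤ Δ → c i ∈[0,1]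
  c∈[0,1] 1≤i i≤Δ = unscale-∈[0,1] 1≤i (scaled-c∈[0,1] 1≤i (ℕ.≤⇒≤‴ i≤Δ))

  c-suc-≤ : ∀ {i} → 1 ≤ i → suc i ≤ Δ → c (suc i) ℚ.≤ c i
  c-suc-≤ {i} 1≤i i<Δ = *-cancelˡ-≤-ℕtoℚ {i} 1≤i (+-cancelʳ-≤ (c (suc i)) (begin
      ℕtoℚ i ℚ.* c (suc i) ℚ.+ c (suc i) ≡⟨ ℕtoℚ-suc-* i (c (suc i)) ⟨
      ℕtoℚ (suc i) ℚ.* c (suc i)          ≤⟨ proj₂ (scaled-c∈[0,1] (s≤s z≤n) (ℕ.≤⇒≤‴ i<Δ)) ⟩
      1ℚ                                  ≡⟨ c-step i 1≤i i<Δ ⟨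
      ℕtoℚ i ℚ.* c i ℚ.+ c (suc i)        ∎))
    where open ℚ.≤-Reasoning

  c-antitone : ∀ {i j} → 1 ≤ i → i ≤ j → j ≤ Δ → c j ℚ.≤ c i
  c-antitone 1≤i i≤j = go 1≤i (ℕ.≤⇒≤‴ i≤j)
    where
    go : ∀ {i j} → 1 ≤ i → i ≤‴ j → j ≤ Δ → c j ℚ.≤ c i
    go _ ≤‴-refl _ = ℚ.≤-refl
    go 1≤i (≤‴-step i<‴j) j≤Δ =
      ℚ.≤-trans (go (s≤s z≤n) i<‴j j≤Δ) (c-suc-≤ 1≤i (ℕ.≤-trans (ℕ.≤‴⇒≤ i<‴j) j≤Δ))

  light-closedNbhd : ∀ {n} (G : Graph n) {δ} → (∀ v → δ ≤ deg G v) → (∀ v → deg G v ≤ Δ) → δ < Δ →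
                     ∀ {x y} → deg G x ≡ δ → adj G x y ≡ true → δ < deg G y →
                     closedSum G (λ v → c (deg G v)) x ℚ.≤ 1ℚ
  light-closedNbhd {n} G {δ} δ≤deg deg≤Δ δ<Δ {x} {y} dx x~y δ<dy = begin
      c (deg G x) ℚ.+ Σℚ L nbhd
        ≡⟨ cong (λ d → c d ℚ.+ Σℚ L nbhd) dx ⟩
      c δ ℚ.+ Σℚ L nbhd
        ≤⟨ ℚ.+-monoʳ-≤ (c δ) (Σℚ-mono-≤ L nbhd≤) ⟩
      c δ ℚ.+ Σℚ L (λ w → base w ℚ.+ excess w)
        ≡⟨ cong (c δ ℚ.+_) (trans (Σℚ-+ L base excess)
             (cong₂ ℚ._+_ (Σℚ-indicator L (adj G x) (c δ)) (Σℚ-indicator L ｛ y ｝ (c (suc δ) ℚ.- c δ)))) ⟩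
      c δ ℚ.+ (ℕtoℚ (deg G x) ℚ.* c δ ℚ.+ ℕtoℚ (count ｛ y ｝) ℚ.* (c (suc δ) ℚ.- c δ))
        ≡⟨ cong₂ (λ d k → c δ ℚ.+ (ℕtoℚ d ℚ.* c δ ℚ.+ ℕtoℚ k ℚ.* (c (suc δ) ℚ.- c δ))) dx (count-｛｝ y) ⟩
      c δ ℚ.+ (ℕtoℚ δ ℚ.* c δ ℚ.+ 1ℚ ℚ.* (c (suc δ) ℚ.- c δ))
        ≡⟨ solve 3 (λ a b d → a :+ (d :* a :+ con 1ℚ :* (b :- a)) := d :* a :+ b) refl
             (c δ) (c (suc δ)) (ℕtoℚ δ) ⟩
      ℕtoℚ δ ℚ.* c δ ℚ.+ c (suc δ)
        ≡⟨ c-step δ 1≤δ δ<Δ ⟩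
      1ℚ ∎
    where
    open ℚ.≤-Reasoning
    open +-*-Solver
    L : List (Fin n)
    L = allFin n
    1≤δ : 1 ≤ δ
    1≤δ = subst (1 ≤_) dx (count-positive (adj G x) x~y)
    nbhd base excess : Fin n → ℚ
    nbhd w   = if adj G x w then c (deg G w) else 0ℚ
    base w   = if adj G x w then c δ else 0ℚ
    excess w = if ｛ y ｝ w then c (suc δ) ℚ.- c δ else 0ℚ
    nbhd≤ : ∀ w → nbhd w ℚ.≤ base w ℚ.+ excess w
    nbhd≤ w with y Fin.≟ w
    ... | yes refl rewrite x~y =
      subst (c (deg G y) ℚ.≤_) (solve 2 (λ a b → b := a :+ (b :- a)) refl (c δ) (c (suc δ)))
        (c-antitone (s≤s z≤n) δ<dy (deg≤Δ y))
    ... | no _ with adj G x w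
    ...   | true  = subst (c (deg G w) ℚ.≤_) (≡.sym (ℚ.+-identityʳ (c δ)))
                      (c-antitone 1≤δ (δ≤deg w) (deg≤Δ w))
    ...   | false = ℚ.≤-refl

  exists-light-closedNbhd : ∀ {n} (G : Graph n) {δ} → Connected G → MaxDegree G Δ → MinDegree G δ → δ < Δ →
                            ∃ λ u → deg G u ≡ δ × closedSum G (λ v → c (deg G v)) u ℚ.≤ 1ℚ
  exists-light-closedNbhd G {δ} connected (deg≤Δ , z , dz) (δ≤deg , v₀ , dv₀) δ<Δ
    with walk-crosses G (λ v → deg G v ℕ.≟ δ) (connected v₀ z) dv₀
           (λ dz≡δ → ℕ.<⇒≢ δ<Δ (trans (≡.sym dz≡δ) dz))
  ... | x , y , dx , x~y , dy≢δ =
    x , dx , light-closedNbhd G δ≤deg deg≤Δ δ<Δ dx x~y (ℕ.≤∧≢⇒< (δ≤deg y) (dy≢δ ∘ ≡.sym))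

  weight≤1 : ∀ {n} (G : Graph n) → Connected G → MaxDegree G Δ → 1 ≤ Δ → ∀ v → c (deg G v) ℚ.≤ 1ℚ
  weight≤1 G connected (deg≤Δ , z , dz) 1≤Δ v =
    proj₂ (c∈[0,1] (degree-positive G connected (subst (1 ≤_) (≡.sym dz) 1≤Δ) v) (deg≤Δ v))

lemma2 : (Δ : ℕ) → 4 ≤ Δ
  → (n : ℕ) (G : Graph n)
  → Connected G → MaxDegree G Δ → ¬ IsComplete G (suc Δ)
  → (δ : ℕ) → MinDegree G δ → δ ≤ Δ ∸ 1
  → (c : ℕ → ℚ)
  → ℕtoℚ Δ ℚ.* c Δ ≡ 1ℚ
  → (∀ i → 1 ≤ i → suc i ≤ Δ → ℕtoℚ i ℚ.* c i ℚ.+ c (suc i) ≡ 1ℚ)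
  → let f : Fin n → ℚ
        f v = c (deg G v)
    in (∃ λ u → deg G u ≡ δ × closedSum G f u ℚ.≤ 1ℚ)
       × (∀ u → deg G u ≡ δ → closedSum G f u ℚ.≤ 1ℚ
            → let S = minusClosedNbhd G u
              in (R : Fin n → Fin n → Bool)
                 → (∀ v w → (R v w ≡ true) ⇔ Reach G S v w)
                 → (a : Fin n → ℕ)
                 → (∀ v → isCompRep G S R v ≡ true → IsIndepNum G (R v) (a v))
                 → (α : ℕ) → IsIndepNum G full α
                 → sumℚ (λ v → if isolatedIn G S v then f v else 0ℚ)
                     ℚ.+ sumℚ (λ v → if isCompRep G S R v then ℕtoℚ (a v) else 0ℚ)
                     ℚ.+ closedSum G f u
                   ℚ.≤ ℕtoℚ α)
lemma2 (suc Δ′) (s≤s _) n G connected maxDeg _ δ minDeg δ≤Δ′ c c-top c-step =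
  exists-light-closedNbhd G connected maxDeg minDeg (s≤s δ≤Δ′) ,
  λ u _ → independence-lower-bound G _ (weight≤1 G connected maxDeg (s≤s z≤n)) u
  where open Coefficients (suc Δ′) c c-top c-step
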